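{- Let $\mathit{Prog}$ be any CLP program (in the setting described in the context, containing the nullary predicate $\mathtt{unsafe}$ and no two identical predicate symbols with different arities). Then the cFAR algorithm applied to $\mathit{Prog}$ terminates and produces a CLP program $\mathit{Prog}|_E$, where $E$ is the erasure it computes, such that $\mathtt{unsafe} \in \mathcal{M}(\mathit{Prog})$ if and only if $\mathtt{unsafe} \in \mathcal{M}(\mathit{Prog}|_E)$.
   Context: A CLP program is a finite set of clauses $\mathtt{H \,\text{:- }\, c, G}$, where $\mathtt{H}$ is an atom, $\mathtt{G}$ a conjunction of atoms and $\mathtt{c}$ a constraint of the form $\mathtt{c_1}\wedge\dots\wedge\mathtt{c_h}$ ($h\ge 0$) of atomic constraints in the theory $\mathcal{A}$ of linear integer arithmetic with integer arrays. $\mathcal{M}(P)$ denotes the least model of $P$; $\mathtt{unsafe}$ is a nullary predicate. An erasure is a set of pairs $(\mathtt{p},k)$ with $\mathtt{p}$ a predicate symbol of arity $n$ and $1\le k\le n$. For an atom $\mathtt{A}$ with predicate $\mathtt{p}$, the erased atom $\mathtt{A}|_E$ is obtained by dropping every argument at a position $k$ with $(\mathtt{p},k)\in E$; $C|_E$ and $\mathit{Prog}|_E$ are obtained by replacing every atom $\mathtt{A}$ by $\mathtt{A}|_E$. Given variables $\mathtt{X},\mathtt{Y}$ and a constraint $\mathtt{c}=\mathtt{c_1}\wedge\dots\wedge\mathtt{c_h}$, $\mathtt{X}$ is constrained to $\mathtt{Y}$ in $\mathtt{c}$ if there is $j$ such that either (i) $\{\mathtt{X},\mathtt{Y}\}\subseteq\mathit{vars}(\mathtt{c_j})$,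 or (ii) there is a variable $\mathtt{Z}$ with $\{\mathtt{X},\mathtt{Z}\}\subseteq\mathit{vars}(\mathtt{c_j})$ and $\mathtt{Z}$ constrained to $\mathtt{Y}$ in $\mathtt{c}$. An erasure $E$ is safe for $\mathit{Prog}$ if for every $(\mathtt{p},k)\in E$ and every clause $\mathtt{H\,\text{:- }\,c,G}$ of $\mathit{Prog}$ with $\mathtt{H}=\mathtt{p(X_1,\dots,X_n)}$ and $\mathtt{c}=\mathtt{c_1}\wedge\dots\wedge\mathtt{c_h}$: (i) $\mathtt{X_k}$ is a variable and $\mathcal{A}\models\forall \mathtt{X_k}\,\exists \mathtt{Y_1},\dots,\mathtt{Y_m}.\,\mathtt{c}$, where $\{\mathtt{Y_1},\dots,\mathtt{Y_m}\}=\mathit{vars}(\mathtt{c})\setminus\{\mathtt{X_k}\}$; (ii) $\mathtt{X_k}$ is not constrained (in $\mathtt{c}$) to any other variable occurring in $\mathtt{H}$; (iii) $\mathtt{X_k}$ is not constrained to any variable occurring in $\mathtt{G}|_E$. The cFAR (constrained FAR) algorithm: initialize $E$ to the full erasure, i.e. the set of all $(\mathtt{p},k)$ with $\mathtt{p}$ a predicate of arity $n$ occurring in $\mathit{Prog}$ and $1\le k\le n$; while $E$ contains a pair $(\mathtt{p},k)$ for which one of conditions (i)–(iii) above fails (for some clause of $\mathit{Prog}$ with head predicate $\mathtt{p}$), remove that pair from $E$; when no pair can be removed, output $\mathit{Prog}|_E$.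
   Formalization: In conditions (ii) and (iii) Xₖ may not itself occur at another head position or in $G|_E$, so constrained to is taken as reflexive, and each predicate symbol has fixed argument sorts, not only a fixed arity. Apart from conventions, each condition added here is assumed in the paper as well or is needed for the statement above to hold. -}

module Defs where

open import Data.Nat as ℕ using (ℕ; zero; suc)
import Data.Nat.Properties as ℕP
open import Data.Integer as ℤ using (ℤ)
import Data.Integer.Properties as ℤP
open import Data.Bool using (Bool; true; false; if_then_else_)
open import Data.List using (List; []; _∷_; map; concatMap; filter; upTo; _++_)
open import Data.List.Relation.Unary.All using (All)
open import Data.List.Relation.Unary.Any using (any?)
open import Data.List.Relation.Binary.Pointwise using (Pointwise)
open import Data.List.Membership.Propositional using (_∈_)
open import Data.Product using (Σ; Σ-syntax; ∃; _×_; _,_; proj₁; proj₂)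
open import Data.Product.Properties using (≡-dec)
open import Data.Empty using (⊥)
open import Data.Sum using (_⊎_)
open import Relation.Nullary using (¬_; Dec; yes; no; ¬?)
open import Relation.Nullary.Decidable using (⌊_⌋)
open import Relation.Binary.PropositionalEquality using (_≡_; _≢_)
open import Relation.Binary.Construct.Closure.ReflexiveTransitive using (Star)
open import Induction.WellFounded using (Acc)

data Sort : Set where
  int arr : Sort

Var : Set
Var = Sort × ℕ

Val : Sort → Set
Val int = ℤ
Val arr = ℤ → ℤ

data Term : Sort → Set where
  var   : ∀ {s} → ℕ → Term s
  num   : ℤ → Term int
  plus  : Term int → Term int → Term int
  scale : ℤ → Term int → Term int
  read  : Term arr → Term int → Term int
  write : Term arr → Term int → Term int → Term arr

data ACon : Set where
  eqI  : Term int → Term int → ACon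
  neqI : Term int → Term int → ACon
  leqI : Term int → Term int → ACon
  ltI  : Term int → Term int → ACon
  eqA  : Term arr → Term arr → ACon

Constraint : Set
Constraint = List ACon

Assign : Set
Assign = (x : Var) → Val (proj₁ x)

⟦_⟧ : ∀ {s} → Term s → Assign → Val s
⟦ var {s} n ⟧ σ = σ (s , n)
⟦ num z ⟧ σ = z
⟦ plus t u ⟧ σ = ⟦ t ⟧ σ ℤ.+ ⟦ u ⟧ σ
⟦ scale z t ⟧ σ = z ℤ.* ⟦ t ⟧ σ
⟦ read a i ⟧ σ = ⟦ a ⟧ σ (⟦ i ⟧ σ)
⟦ write a i v ⟧ σ = λ j → if ⌊ j ℤ.≟ ⟦ i ⟧ σ ⌋ then ⟦ v ⟧ σ else ⟦ a ⟧ σ j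

SatA : Assign → ACon → Set
SatA σ (eqI t u)  = ⟦ t ⟧ σ ≡ ⟦ u ⟧ σ
SatA σ (neqI t u) = ⟦ t ⟧ σ ≢ ⟦ u ⟧ σ
SatA σ (leqI t u) = ⟦ t ⟧ σ ℤ.≤ ⟦ u ⟧ σ
SatA σ (ltI t u)  = ⟦ t ⟧ σ ℤ.< ⟦ u ⟧ σ
SatA σ (eqA a b)  = ∀ i → ⟦ a ⟧ σ i ≡ ⟦ b ⟧ σ i

Sat : Assign → Constraint → Set
Sat σ c = All (SatA σ) c

varsT : ∀ {s} → Term s → List Var
varsT (var {s} n) = (s , n) ∷ []
varsT (num z) = []
varsT (plus t u) = varsT t ++ varsT u
varsT (scale z t) = varsT t
varsT (read a i) = varsT a ++ varsT i
varsT (write a i v) = varsT a ++ varsT i ++ varsT v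

varsA : ACon → List Var
varsA (eqI t u)  = varsT t ++ varsT u
varsA (neqI t u) = varsT t ++ varsT u
varsA (leqI t u) = varsT t ++ varsT u
varsA (ltI t u)  = varsT t ++ varsT u
varsA (eqA a b)  = varsT a ++ varsT b

Arg : Set
Arg = Σ Sort Term

record Atom : Set where
  constructor atom
  field
    pred : ℕ
    args : List Arg
open Atom public

record Clause : Set where
  constructor _:-_,_
  field
    head   : Atom
    constr : Constraint
    body   : List Atom
open Clause public

Program : Set
Program = List Clause

varsArg : Arg → List Var
varsArg (s , t) = varsT t

varsAtom : Atom → List Var
varsAtom A = concatMap varsArg (args A)

varsAtoms : List Atom → List Var
varsAtoms G = concatMap varsAtom G

GVal : Set
GVal = Σ Sort Val

ValEq : GVal → GVal → Set
ValEq (int , x) (int , y) = x ≡ y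
ValEq (arr , f) (arr , g) = ∀ i → f i ≡ g i
ValEq (int , _) (arr , _) = ⊥
ValEq (arr , _) (int , _) = ⊥

evalArg : Assign → Arg → GVal
evalArg σ (s , t) = s , ⟦ t ⟧ σ

evalArgs : Assign → List Arg → List GVal
evalArgs σ ts = map (evalArg σ) ts

-- Holds P p vs  ⇔  p(vs) ∈ ℳ(P)
data Holds (P : Program) : ℕ → List GVal → Set where
  derive : ∀ {cl} → cl ∈ P → (σ : Assign) → Sat σ (constr cl) →
           All (λ A → Holds P (pred A) (evalArgs σ (args A))) (body cl) →
           ∀ {vs} → Pointwise ValEq (evalArgs σ (args (head cl))) vs →
           Holds P (pred (head cl)) vs

-- Erasures: finite sets of pairs (p , k), k ≥ 1 (positions are 1-based)

Erasure : Set
Erasure = List (ℕ × ℕ)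

_≟ₚ_ : (a b : ℕ × ℕ) → Dec (a ≡ b)
_≟ₚ_ = ≡-dec ℕ._≟_ ℕ._≟_

inE : Erasure → ℕ × ℕ → Bool
inE E q = ⌊ any? (λ r → r ≟ₚ q) E ⌋

dropArgs : Erasure → ℕ → ℕ → List Arg → List Arg
dropArgs E p i [] = []
dropArgs E p i (t ∷ ts) =
  if inE E (p , i) then dropArgs E p (suc i) ts else t ∷ dropArgs E p (suc i) ts

eraseAtom : Erasure → Atom → Atom
eraseAtom E (atom p ts) = atom p (dropArgs E p 1 ts)

eraseClause : Erasure → Clause → Clause
eraseClause E (h :- c , g) = eraseAtom E h :- c , map (eraseAtom E) g

eraseProg : Erasure → Program → Program
eraseProg E P = map (eraseClause E) P

data Constrained (c : Constraint) (X Y : Var) : Set where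
  direct : ∀ {a} → a ∈ c → X ∈ varsA a → Y ∈ varsA a → Constrained c X Y
  trans  : ∀ {a Z} → a ∈ c → X ∈ varsA a → Z ∈ varsA a →
           Constrained c Z Y → Constrained c X Y

Linked : Constraint → Var → Var → Set
Linked c X Y = (X ≡ Y) ⊎ Constrained c X Y

data _[_]=_ {A : Set} : List A → ℕ → A → Set where
  here  : ∀ {x xs} → (x ∷ xs) [ 1 ]= x
  there : ∀ {x y xs k} → xs [ k ]= y → (x ∷ xs) [ suc k ]= y

-- Conditions (i)–(iii) for position k of the clause cl w.r.t. erasure E

CondAt : Erasure → Clause → ℕ → Set
CondAt E cl k =
  Σ Sort λ s → Σ ℕ λ n →
    (args (head cl) [ k ]= (s , var n))
    -- (i) 𝒜 ⊨ ∀Xₖ ∃Y₁…Yₘ. c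
    × (∀ (v : Val s) → Σ Assign λ σ → (σ (s , n) ≡ v) × Sat σ (constr cl))
    × (∀ j → j ≢ k → ∀ a → args (head cl) [ j ]= a →
         ∀ Y → Y ∈ varsArg a → ¬ Linked (constr cl) (s , n) Y)
    × (∀ Y → Y ∈ varsAtoms (map (eraseAtom E) (body cl)) →
         ¬ Linked (constr cl) (s , n) Y)

SafeErasure : Program → Erasure → Set
SafeErasure P E =
  ∀ {p k} → (p , k) ∈ E → ∀ {cl} → cl ∈ P → pred (head cl) ≡ p → CondAt E cl k

positions : ℕ → ℕ → List (ℕ × ℕ)
positions p n = map (λ i → p , suc i) (upTo n)

atomsOf : Clause → List Atom
atomsOf cl = head cl ∷ body cl

fullErasure : Program → Erasure
fullErasure P =
  concatMap (λ cl → concatMap (λ A → positions (pred A) (Data.List.length (args A))) (atomsOf cl)) P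

removePair : ℕ × ℕ → Erasure → Erasure
removePair q E = filter (λ r → ¬? (r ≟ₚ q)) E

Step : Program → Erasure → Erasure → Set
Step P E E' =
  Σ ℕ λ p → Σ ℕ λ k → ((p , k) ∈ E) ×
    (Σ Clause λ cl → (cl ∈ P) × (pred (head cl) ≡ p) × ¬ CondAt E cl k) ×
    (E' ≡ removePair (p , k) E)

Reachable : Program → Erasure → Set
Reachable P E = Star (Step P) (fullErasure P) E

Terminates : Program → Set
Terminates P = Acc (λ E' E → Step P E E') (fullErasure P)

-- Well-formedness of programs: every predicate symbol has a fixed
-- arity (indeed a fixed sort signature), and unsafe (= u) is nullary.

WellFormed : Program → ℕ → Set
WellFormed P u = Σ (ℕ → List Sort) λ sig →
  All (λ cl → All (λ A → map proj₁ (args A) ≡ sig (pred A)) (atomsOf cl)) P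
  × (sig u ≡ [])

module Submission where

-- Termination: every step removes a pair that belongs to the current
-- erasure, so the length of the erasure strictly decreases.
--
-- Existence of a result: running the algorithm from the full erasure we
-- reach, by well-founded recursion, an erasure from which no step is
-- possible; such a "stuck" erasure is safe up to double negation, since
-- "no step" says that conditions (i)-(iii) never fail.  Deciding whether
-- a step exists is classical, hence the result is stated under ¬ ¬.
--
-- Preservation of unsafe: the forward direction holds for every erasure
-- (erase the arguments along a derivation).  For the backward direction
-- we rebuild the erased arguments of each clause instance: the value of
-- an erased head variable X can be chosen freely by condition (i), and
-- re-choosing it only changes the assignment on the variables linked to
-- X, which by (ii) and (iii) occur neither in the other head arguments
-- nor in the erased body.

open import Defs
open import Data.Nat using (ℕ; suc; _≤_; _<_; _+_)
import Data.Nat as ℕ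
import Data.Nat.Properties as ℕP
open import Data.Nat.Induction using (<-wellFounded)
import Data.Integer as ℤ
open import Data.Bool using (true; false; if_then_else_)
open import Data.List using (List; []; _∷_; map; concatMap; length; _++_)
open import Data.List.Properties using (filter-notAll; ∷-injectiveˡ; ∷-injectiveʳ)
open import Data.List.Relation.Unary.All as All using (All; []; _∷_)
open import Data.List.Relation.Unary.Any as Any using (Any; here; there; any?)
open import Data.List.Relation.Binary.Pointwise as Pointwise using (Pointwise; []; _∷_)
open import Data.List.Membership.Propositional using (_∈_; find; lose)
open import Data.List.Membership.Propositional.Properties using (∈-++⁺ˡ; ∈-++⁺ʳ; ∈-++⁻; ∈-map⁺; ∈-map⁻)
open import Data.Product using (Σ; ∃; _×_; _,_; proj₁; proj₂)
open import Data.Sum using (_⊎_; inj₁; inj₂; [_,_])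
open import Data.Empty using (⊥-elim)
open import Relation.Nullary using (¬_; Dec; yes; no; ¬?)
open import Relation.Nullary.Decidable using (¬¬-excluded-middle)
open import Relation.Nullary.Negation using (¬¬-map)
open import Relation.Binary.PropositionalEquality
  using (_≡_; _≢_; refl; sym; cong; cong₂; subst; subst₂)
  renaming (trans to ≡-trans)
open import Relation.Binary.Construct.Closure.ReflexiveTransitive using (ε; _◅_; _◅◅_)
open import Relation.Binary.Construct.On as On using ()
open import Induction.WellFounded using (WellFounded; Acc; acc; module Subrelation)
open import Function.Bundles using (_⇔_; mk⇔)

module _ (P : Program) where

  -- A step removes a pair occurring in E, so the erasure gets shorter.
  step-shrinks : ∀ {E E'} → Step P E E' → length E' < length E
  step-shrinks (p , k , pk∈E , _ , refl) =
    filter-notAll (λ r → ¬? (r ≟ₚ (p , k))) _ (Any.map (λ eq ne → ne (sym eq)) pk∈E)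

  cFAR-wellFounded : WellFounded (λ E' E → Step P E E')
  cFAR-wellFounded = Subrelation.wellFounded step-shrinks (On.wellFounded length <-wellFounded)

¬¬-all : {A : Set} {B : A → Set} (xs : List A) →
         (∀ x → x ∈ xs → ¬ ¬ B x) → ¬ ¬ (∀ x → x ∈ xs → B x)
¬¬-all [] _ k = k (λ _ ())
¬¬-all (x ∷ xs) h k =
  h x (here refl) λ bx → ¬¬-all xs (λ y y∈xs → h y (there y∈xs)) λ f →
    k λ where y (here refl) → bx
              y (there y∈xs) → f y y∈xs

¬¬-premise : {A B : Set} → (A → ¬ ¬ B) → ¬ ¬ (A → B)
¬¬-premise h k = k λ a → ⊥-elim (h a λ b → k λ _ → b)

module _ (P : Program) where

  Stuck : Erasure → Set
  Stuck E = ¬ (∃ λ E' → Step P E E')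

  stuck⇒¬¬safe : ∀ {E} → Stuck E → ¬ ¬ SafeErasure P E
  stuck⇒¬¬safe {E} stuck =
    ¬¬-map (λ f {p} {k} pk∈E {cl} cl∈P eq → f (p , k) pk∈E cl cl∈P eq)
      (¬¬-all {B = λ q → ∀ cl → cl ∈ P → pred (head cl) ≡ proj₁ q → CondAt E cl (proj₂ q)} E
        λ (p , k) pk∈E → ¬¬-all P λ cl cl∈P → ¬¬-premise λ eq ¬cond →
          stuck (_ , p , k , pk∈E , (cl , cl∈P , eq , ¬cond) , refl))

  reach-safe : ∀ E → Acc (λ E' E → Step P E E') E → Reachable P E →
               ¬ ¬ (∃ λ E → Reachable P E × SafeErasure P E)
  reach-safe E (acc rs) reach k = ¬¬-excluded-middle {A = ∃ λ E' → Step P E E'} λ where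
    (yes (E' , step)) → reach-safe E' (rs step) (reach ◅◅ step ◅ ε) k
    (no stuck) → stuck⇒¬¬safe stuck λ safe → k (E , reach , safe)

ValEq-refl : ∀ {x} → ValEq x x
ValEq-refl {int , _} = refl
ValEq-refl {arr , _} _ = refl

ValEq-sym : ∀ {x y} → ValEq x y → ValEq y x
ValEq-sym {int , _} {int , _} e = sym e
ValEq-sym {arr , _} {arr , _} e i = sym (e i)

ValEq-trans : ∀ {x y z} → ValEq x y → ValEq y z → ValEq x z
ValEq-trans {int , _} {int , _} {int , _} e f = ≡-trans e f
ValEq-trans {arr , _} {arr , _} {arr , _} e f i = ≡-trans (e i) (f i)

value-of-sort : ∀ s (v : GVal) → proj₁ v ≡ s → Σ (Val s) λ w → ValEq (s , w) v
value-of-sort s (s , w) refl = w , ValEq-refl {s , w}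

dropG : {A : Set} → Erasure → ℕ → ℕ → List A → List A
dropG E p i [] = []
dropG E p i (x ∷ xs) =
  if inE E (p , i) then dropG E p (suc i) xs else x ∷ dropG E p (suc i) xs

dropArgs≡dropG : ∀ E p i ts → dropArgs E p i ts ≡ dropG E p i ts
dropArgs≡dropG E p i [] = refl
dropArgs≡dropG E p i (t ∷ ts) with inE E (p , i)
... | true = dropArgs≡dropG E p (suc i) ts
... | false = cong (t ∷_) (dropArgs≡dropG E p (suc i) ts)

map-dropG : ∀ {A B : Set} (f : A → B) E p i xs → map f (dropG E p i xs) ≡ dropG E p i (map f xs)
map-dropG f E p i [] = refl
map-dropG f E p i (x ∷ xs) with inE E (p , i)
... | true = map-dropG f E p (suc i) xs
... | false = cong (f x ∷_) (map-dropG f E p (suc i) xs)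

dropG-pointwise : ∀ {A B : Set} {R : A → B → Set} {xs ys} E p i →
                  Pointwise R xs ys → Pointwise R (dropG E p i xs) (dropG E p i ys)
dropG-pointwise E p i [] = []
dropG-pointwise E p i (r ∷ rs) with inE E (p , i)
... | true = dropG-pointwise E p (suc i) rs
... | false = r ∷ dropG-pointwise E p (suc i) rs

eval-drop : ∀ σ E p ts → evalArgs σ (dropArgs E p 1 ts) ≡ dropG E p 1 (evalArgs σ ts)
eval-drop σ E p ts = ≡-trans (cong (evalArgs σ) (dropArgs≡dropG E p 1 ts)) (map-dropG (evalArg σ) E p 1 ts)

inE⇒∈ : ∀ E q → inE E q ≡ true → q ∈ E
inE⇒∈ E q eq with any? (λ r → r ≟ₚ q) E
inE⇒∈ E q eq | yes q∈E = Any.map sym q∈E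
inE⇒∈ E q () | no _

module Forward (P : Program) (E : Erasure) where
  mutual
    erase-holds : ∀ {p vs} → Holds P p vs → Holds (eraseProg E P) p (dropG E p 1 vs)
    erase-holds (derive {cl} cl∈P σ sat body-holds head≈) =
      derive (∈-map⁺ (eraseClause E) cl∈P) σ sat (erase-body σ (body cl) body-holds)
        (subst (λ ws → Pointwise ValEq ws _) (sym (eval-drop σ E _ (args (head cl))))
               (dropG-pointwise E _ 1 head≈))

    erase-body : ∀ σ G → All (λ A → Holds P (pred A) (evalArgs σ (args A))) G →
                 All (λ A → Holds (eraseProg E P) (pred A) (evalArgs σ (args A))) (map (eraseAtom E) G)
    erase-body σ [] [] = []
    erase-body σ (A ∷ G) (h ∷ hs) =
      subst (Holds (eraseProg E P) (pred A)) (sym (eval-drop σ E (pred A) (args A))) (erase-holds h)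
      ∷ erase-body σ G hs

Agree : Assign → Assign → List Var → Set
Agree σ τ vs = ∀ Y → Y ∈ vs → σ Y ≡ τ Y

agree-++ˡ : ∀ {σ τ xs ys} → Agree σ τ (xs ++ ys) → Agree σ τ xs
agree-++ˡ h Y Y∈xs = h Y (∈-++⁺ˡ Y∈xs)

agree-++ʳ : ∀ {σ τ} xs {ys} → Agree σ τ (xs ++ ys) → Agree σ τ ys
agree-++ʳ xs h Y Y∈ys = h Y (∈-++⁺ʳ xs Y∈ys)

agree-term : ∀ {s σ τ} (t : Term s) → Agree σ τ (varsT t) → ValEq (s , ⟦ t ⟧ σ) (s , ⟦ t ⟧ τ)
agree-term {int} (var n) h = h _ (here refl)
agree-term {arr} (var n) h i = cong (λ f → f i) (h _ (here refl))
agree-term (num z) h = refl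
agree-term (plus t u) h = cong₂ ℤ._+_ (agree-term t (agree-++ˡ h)) (agree-term u (agree-++ʳ (varsT t) h))
agree-term (scale z t) h = cong (z ℤ.*_) (agree-term t h)
agree-term {σ = σ} {τ} (read a i) h =
  ≡-trans (agree-term a (agree-++ˡ h) (⟦ i ⟧ σ)) (cong (⟦ a ⟧ τ) (agree-term i (agree-++ʳ (varsT a) h)))
agree-term (write a i v) h j
  rewrite agree-term i (agree-++ˡ (agree-++ʳ (varsT a) h))
        | agree-term v (agree-++ʳ (varsT i) (agree-++ʳ (varsT a) h))
        | agree-term a (agree-++ˡ h) j = refl

agree-atom : ∀ {σ τ} (a : ACon) → Agree σ τ (varsA a) → SatA σ a → SatA τ a
agree-atom (eqI t u) h s =
  ≡-trans (sym (agree-term t (agree-++ˡ h))) (≡-trans s (agree-term u (agree-++ʳ (varsT t) h)))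
agree-atom (neqI t u) h s e =
  s (≡-trans (agree-term t (agree-++ˡ h)) (≡-trans e (sym (agree-term u (agree-++ʳ (varsT t) h)))))
agree-atom (leqI t u) h s = subst₂ ℤ._≤_ (agree-term t (agree-++ˡ h)) (agree-term u (agree-++ʳ (varsT t) h)) s
agree-atom (ltI t u) h s = subst₂ ℤ._<_ (agree-term t (agree-++ˡ h)) (agree-term u (agree-++ʳ (varsT t) h)) s
agree-atom (eqA t u) h s i =
  ≡-trans (sym (agree-term t (agree-++ˡ h) i)) (≡-trans (s i) (agree-term u (agree-++ʳ (varsT t) h) i))

varsArgs : List Arg → List Var
varsArgs ts = concatMap varsArg ts

agree-arg : ∀ {σ τ} a → Agree σ τ (varsArg a) → ValEq (evalArg σ a) (evalArg τ a)
agree-arg (s , t) h = agree-term t h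

agree-args : ∀ {σ τ} ts → Agree σ τ (varsArgs ts) → Pointwise ValEq (evalArgs σ ts) (evalArgs τ ts)
agree-args [] h = []
agree-args (a ∷ ts) h = agree-arg a (agree-++ˡ h) ∷ agree-args ts (agree-++ʳ (varsArg a) h)

constrained-trans : ∀ {c X Z Y} → Constrained c X Z → Constrained c Z Y → Constrained c X Y
constrained-trans (direct a∈c X∈a Z∈a) r = trans a∈c X∈a Z∈a r
constrained-trans (trans a∈c X∈a W∈a q) r = trans a∈c X∈a W∈a (constrained-trans q r)

linked-trans : ∀ {c X Z Y} → Linked c X Z → Linked c Z Y → Linked c X Y
linked-trans (inj₁ refl) r = r
linked-trans (inj₂ q) (inj₁ refl) = inj₂ q
linked-trans (inj₂ q) (inj₂ r) = inj₂ (constrained-trans q r)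

linked-atom : ∀ {c a X Y} → a ∈ c → X ∈ varsA a → Y ∈ varsA a → Linked c X Y
linked-atom a∈c X∈a Y∈a = inj₂ (direct a∈c X∈a Y∈a)

constrained-weaken : ∀ {a c X Y} → Constrained c X Y → Constrained (a ∷ c) X Y
constrained-weaken (direct a∈c X∈a Y∈a) = direct (there a∈c) X∈a Y∈a
constrained-weaken (trans a∈c X∈a Z∈a q) = trans (there a∈c) X∈a Z∈a (constrained-weaken q)

linked-weaken : ∀ {a c X Y} → Linked c X Y → Linked (a ∷ c) X Y
linked-weaken (inj₁ e) = inj₁ e
linked-weaken (inj₂ q) = inj₂ (constrained-weaken q)

-- A link in a ∷ c that is not a link in c passes through the atom a.
ThroughAtom : ACon → Constraint → Var → Var → Set
ThroughAtom a c X Y = Any (Linked c X) (varsA a) × Any (λ Z → Linked c Z Y) (varsA a)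

through-atom⇒linked : ∀ {a c X Y} → ThroughAtom a c X Y → Linked (a ∷ c) X Y
through-atom⇒linked (X~a , a~Y) with find X~a | find a~Y
... | _ , Z₁∈a , X~Z₁ | _ , Z₂∈a , Z₂~Y =
  linked-trans (linked-weaken X~Z₁)
    (linked-trans (linked-atom (here refl) Z₁∈a Z₂∈a) (linked-weaken Z₂~Y))

constrained-cons⁻ : ∀ {a c X Y} → Constrained (a ∷ c) X Y → Linked c X Y ⊎ ThroughAtom a c X Y
constrained-cons⁻ (direct (here refl) X∈a Y∈a) = inj₂ (lose X∈a (inj₁ refl) , lose Y∈a (inj₁ refl))
constrained-cons⁻ (direct (there b∈c) X∈b Y∈b) = inj₁ (linked-atom b∈c X∈b Y∈b)
constrained-cons⁻ (trans (here refl) X∈a Z∈a q) with constrained-cons⁻ q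
... | inj₁ Z~Y = inj₂ (lose X∈a (inj₁ refl) , lose Z∈a Z~Y)
... | inj₂ (_ , a~Y) = inj₂ (lose X∈a (inj₁ refl) , a~Y)
constrained-cons⁻ (trans (there b∈c) X∈b Z∈b q) with constrained-cons⁻ q
... | inj₁ Z~Y = inj₁ (linked-trans (linked-atom b∈c X∈b Z∈b) Z~Y)
... | inj₂ (Z~a , a~Y) with find Z~a
...   | _ , W∈a , Z~W = inj₂ (lose W∈a (linked-trans (linked-atom b∈c X∈b Z∈b) Z~W) , a~Y)

linked-cons⁻ : ∀ {a c X Y} → Linked (a ∷ c) X Y → Linked c X Y ⊎ ThroughAtom a c X Y
linked-cons⁻ (inj₁ e) = inj₁ (inj₁ e)
linked-cons⁻ (inj₂ q) = constrained-cons⁻ q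

_≟Sort_ : (a b : Sort) → Dec (a ≡ b)
int ≟Sort int = yes refl
int ≟Sort arr = no λ ()
arr ≟Sort int = no λ ()
arr ≟Sort arr = yes refl

_≟Var_ : (X Y : Var) → Dec (X ≡ Y)
(s , n) ≟Var (s' , n') with s ≟Sort s' | n ℕ.≟ n'
... | yes refl | yes refl = yes refl
... | no s≢s' | _ = no λ { refl → s≢s' refl }
... | _ | no n≢n' = no λ { refl → n≢n' refl }

linked? : ∀ c X Y → Dec (Linked c X Y)
linked? [] X Y with X ≟Var Y
... | yes e = yes (inj₁ e)
... | no X≢Y = no λ { (inj₁ e) → X≢Y e ; (inj₂ (direct () _ _)) ; (inj₂ (trans () _ _ _)) }
linked? (a ∷ c) X Y with linked? c X Y
... | yes X~Y = yes (linked-weaken X~Y)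
... | no X≁Y with any? (linked? c X) (varsA a) | any? (λ Z → linked? c Z Y) (varsA a)
...   | yes X~a | yes a~Y = yes (through-atom⇒linked (X~a , a~Y))
...   | no X≁a | _ = no λ X~Y → [ X≁Y , (λ through → X≁a (proj₁ through)) ] (linked-cons⁻ X~Y)
...   | _ | no a≁Y = no λ X~Y → [ X≁Y , (λ through → a≁Y (proj₂ through)) ] (linked-cons⁻ X~Y)

-- patch takes the values of τ on the variables linked to X and those of
-- σ elsewhere; if both satisfy c, so does the patch, because every atomic
-- constraint has either all or none of its variables linked to X.
module Patch (c : Constraint) (X : Var) (σ τ : Assign) where
  patch : Assign
  patch Y with linked? c X Y
  ... | yes _ = τ Y
  ... | no _ = σ Y

  patch-outside : ∀ {Y} → ¬ Linked c X Y → patch Y ≡ σ Y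
  patch-outside {Y} X≁Y with linked? c X Y
  ... | yes X~Y = ⊥-elim (X≁Y X~Y)
  ... | no _ = refl

  patch-inside : ∀ {Y} → Linked c X Y → patch Y ≡ τ Y
  patch-inside {Y} X~Y with linked? c X Y
  ... | yes _ = refl
  ... | no X≁Y = ⊥-elim (X≁Y X~Y)

  patch-sat : Sat σ c → Sat τ c → Sat patch c
  patch-sat sat-σ sat-τ = All.tabulate sat-atom
    where
    sat-atom : ∀ {a} → a ∈ c → SatA patch a
    sat-atom {a} a∈c with any? (linked? c X) (varsA a)
    ... | yes X~a with find X~a
    ...   | _ , Z∈a , X~Z =
      agree-atom a (λ W W∈a → sym (patch-inside (linked-trans X~Z (linked-atom a∈c Z∈a W∈a))))
                 (All.lookup sat-τ a∈c)
    sat-atom {a} a∈c | no X≁a =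
      agree-atom a (λ W W∈a → sym (patch-outside λ X~W → X≁a (lose W∈a X~W))) (All.lookup sat-σ a∈c)

module ErasedPosition (E : Erasure) (cl : Clause) (k : ℕ) (cd : CondAt E cl k) where

  erasedVar : Var
  erasedVar = proj₁ cd , proj₁ (proj₂ cd)

  erased-at : args (head cl) [ k ]= (proj₁ erasedVar , var (proj₂ erasedVar))
  erased-at = proj₁ (proj₂ (proj₂ cd))

  erased-free : (w : Val (proj₁ erasedVar)) → Σ Assign λ τ → (τ erasedVar ≡ w) × Sat τ (constr cl)
  erased-free = proj₁ (proj₂ (proj₂ (proj₂ cd)))

  erased-head-unlinked : ∀ j → j ≢ k → ∀ a → args (head cl) [ j ]= a →
                         ∀ Y → Y ∈ varsArg a → ¬ Linked (constr cl) erasedVar Y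
  erased-head-unlinked = proj₁ (proj₂ (proj₂ (proj₂ (proj₂ cd))))

  erased-body-unlinked : ∀ Y → Y ∈ varsAtoms (map (eraseAtom E) (body cl)) →
                         ¬ Linked (constr cl) erasedVar Y
  erased-body-unlinked = proj₂ (proj₂ (proj₂ (proj₂ (proj₂ cd))))

position-unique : ∀ {A : Set} {xs : List A} {k x y} → xs [ k ]= x → xs [ k ]= y → x ≡ y
position-unique here here = refl
position-unique (there p) (there q) = position-unique p q

-- Walking through the head
-- arguments from position i on, we re-choose the erased variables so
-- that the head evaluates to prescribed values, while keeping the
-- assignment unchanged away from the erased variables.
module Extension (E : Erasure) (cl : Clause)
                 (cond : ∀ k → (pred (head cl) , k) ∈ E → CondAt E cl k) (σ₀ : Assign) where
  private
    p : ℕ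
    p = pred (head cl)
    c : Constraint
    c = constr cl
    hs : List Arg
    hs = args (head cl)

  module Erased {k : ℕ} (k∈E : (p , k) ∈ E) = ErasedPosition E cl k (cond k k∈E)

  Frame : ℕ → Assign → Assign → Set
  Frame i σ' σ = ∀ Y → (∀ k → i ≤ k → (k∈E : (p , k) ∈ E) → ¬ Linked c (Erased.erasedVar k∈E) Y) →
                 σ' Y ≡ σ Y

  frame-weaken : ∀ {i σ' σ} → Frame (suc i) σ' σ → Frame i σ' σ
  frame-weaken frame Y unlinked = frame Y λ k i<k → unlinked k (ℕP.<⇒≤ i<k)

  -- ts is the list of head arguments from position i on
  SuffixFrom : ℕ → List Arg → Set
  SuffixFrom i ts = ∀ {j a} → ts [ suc j ]= a → hs [ j + i ]= a

  suffix-tail : ∀ {i t ts} → SuffixFrom i (t ∷ ts) → SuffixFrom (suc i) ts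
  suffix-tail {i} suffix {j} {a} ts[j]=a =
    subst (λ z → hs [ z ]= a) (sym (ℕP.+-suc j i)) (suffix (there ts[j]=a))

  -- The variables of the argument at position i are not linked to the
  -- erased variables at later positions, by (ii) for those positions.
  head-unlinked-later : ∀ {i t ts} → SuffixFrom i (t ∷ ts) →
    ∀ Y → Y ∈ varsArg t → ∀ k → suc i ≤ k → (k∈E : (p , k) ∈ E) → ¬ Linked c (Erased.erasedVar k∈E) Y
  head-unlinked-later suffix Y Y∈t k i<k k∈E =
    Erased.erased-head-unlinked k∈E _ (λ i≡k → ℕP.<-irrefl i≡k i<k) _ (suffix here) Y Y∈t

  -- The variables of the later arguments are not linked to an erased
  -- variable at position i, by (ii) for position i.
  tail-unlinked : ∀ {i t ts} → SuffixFrom i (t ∷ ts) → (i∈E : (p , i) ∈ E) →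
    ∀ Y → Y ∈ varsArgs ts → ¬ Linked c (Erased.erasedVar i∈E) Y
  tail-unlinked {i} {ts = ts} suffix i∈E Y Y∈ts = later ts (suffix-tail suffix) (ℕP.n<1+n i) Y∈ts
    where
    later : ∀ {m} us → SuffixFrom m us → i < m → Y ∈ varsArgs us → ¬ Linked c (Erased.erasedVar i∈E) Y
    later (u ∷ us) suffix' i<m Y∈us with ∈-++⁻ (varsArg u) Y∈us
    ... | inj₁ Y∈u = Erased.erased-head-unlinked i∈E _ (λ m≡i → ℕP.<-irrefl (sym m≡i) i<m) u (suffix' here) Y Y∈u
    ... | inj₂ Y∈us' = later us (suffix-tail suffix') (ℕP.m<n⇒m<1+n i<m) Y∈us'

  record Extended (i : ℕ) (ts : List Arg) (vs : List GVal) (σ : Assign) : Set where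
    field
      assign    : Assign
      satisfies : Sat assign c
      matches   : Pointwise ValEq (evalArgs assign ts) vs
      frame     : Frame i assign σ
  open Extended

  -- A kept argument already evaluates to the prescribed value under σ,
  -- and the later extension does not touch its variables.
  keep-head : ∀ {i t ts v vs σ} → SuffixFrom i (t ∷ ts) → Agree σ σ₀ (varsArg t) →
              ValEq v (evalArg σ₀ t) → Extended (suc i) ts vs σ → Extended i (t ∷ ts) (v ∷ vs) σ
  keep-head {t = t} {σ = σ} suffix agree v≈t rest = record
    { assign = assign rest
    ; satisfies = satisfies rest
    ; matches = ValEq-trans (agree-arg t unchanged-t) (ValEq-sym v≈t) ∷ matches rest
    ; frame = frame-weaken (frame rest)
    }
    where
    unchanged-t : Agree (assign rest) σ₀ (varsArg t)
    unchanged-t Y Y∈t = ≡-trans (frame rest Y (head-unlinked-later suffix Y Y∈t)) (agree Y Y∈t)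

  -- An erased argument is the variable Xᵢ; we first patch σ with an
  -- assignment giving Xᵢ its prescribed value (condition (i)), then
  -- extend the rest.
  erase-head : ∀ {i t ts v vs σ} (i∈E : (p , i) ∈ E) → SuffixFrom i (t ∷ ts) →
               proj₁ v ≡ proj₁ t → Sat σ c → Agree σ σ₀ (varsArgs ts) →
               (∀ σ' → Sat σ' c → Agree σ' σ₀ (varsArgs ts) → Extended (suc i) ts vs σ') →
               Extended i (t ∷ ts) (v ∷ vs) σ
  erase-head {i} {t} {ts} {v} {vs} {σ} i∈E suffix sort-v sat agree extend-rest = record
    { assign = assign rest
    ; satisfies = satisfies rest
    ; matches = subst (λ u → ValEq (evalArg (assign rest) u) v) (sym t≡X) X-matches ∷ matches rest
    ; frame = λ Y unlinked → ≡-trans (frame rest Y λ k i<k → unlinked k (ℕP.<⇒≤ i<k))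
                                     (patch-outside (unlinked i ℕP.≤-refl i∈E))
    }
    where
    open Erased i∈E
    X : Var
    X = erasedVar
    t≡X : t ≡ (proj₁ X , var (proj₂ X))
    t≡X = position-unique (suffix here) erased-at
    target : Σ (Val (proj₁ X)) λ w → ValEq (proj₁ X , w) v
    target = value-of-sort (proj₁ X) v (≡-trans sort-v (cong proj₁ t≡X))
    w : Val (proj₁ X)
    w = proj₁ target
    τ : Assign
    τ = proj₁ (erased-free w)
    open Patch c X σ τ
    rest : Extended (suc i) ts vs patch
    rest = extend-rest patch (patch-sat sat (proj₂ (proj₂ (erased-free w))))
             λ Y Y∈ts → ≡-trans (patch-outside (tail-unlinked suffix i∈E Y Y∈ts)) (agree Y Y∈ts)
    X∈t : X ∈ varsArg t
    X∈t = subst (λ u → X ∈ varsArg u) (sym t≡X) (here refl)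
    X-value : assign rest X ≡ w
    X-value = ≡-trans (frame rest X (head-unlinked-later suffix X X∈t))
                (≡-trans (patch-inside (inj₁ refl)) (proj₁ (proj₂ (erased-free w))))
    X-matches : ValEq (proj₁ X , assign rest X) v
    X-matches = subst (λ z → ValEq (proj₁ X , z) v) (sym X-value) (proj₂ target)

  extend : ∀ i ts vs σ → SuffixFrom i ts → Sat σ c → Agree σ σ₀ (varsArgs ts) →
           Pointwise ValEq (dropG E p i vs) (evalArgs σ₀ (dropArgs E p i ts)) →
           map proj₁ vs ≡ map proj₁ ts → Extended i ts vs σ
  extend i [] [] σ _ sat _ _ _ =
    record { assign = σ ; satisfies = sat ; matches = [] ; frame = λ _ _ → refl }
  extend i (t ∷ ts) (v ∷ vs) σ suffix sat agree kept sorts with inE E (p , i) in eq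
  ... | false with kept
  ...   | v≈t ∷ kept' =
    keep-head suffix (agree-++ˡ agree) v≈t
      (extend (suc i) ts vs σ (suffix-tail suffix) sat (agree-++ʳ (varsArg t) agree) kept' (∷-injectiveʳ sorts))
  extend i (t ∷ ts) (v ∷ vs) σ suffix sat agree kept sorts | true =
    erase-head (inE⇒∈ E (p , i) eq) suffix (∷-injectiveˡ sorts) sat (agree-++ʳ (varsArg t) agree)
      λ σ' sat' agree' → extend (suc i) ts vs σ' (suffix-tail suffix) sat' agree' kept (∷-injectiveʳ sorts)

  extend-head : ∀ vs → Sat σ₀ c → Pointwise ValEq (dropG E p 1 vs) (evalArgs σ₀ (dropArgs E p 1 hs)) →
                map proj₁ vs ≡ map proj₁ hs → Extended 1 hs vs σ₀
  extend-head vs sat kept sorts = extend 1 hs vs σ₀ at-one sat (λ _ _ → refl) kept sorts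
    where
    at-one : SuffixFrom 1 hs
    at-one {j} {a} hs[j]=a = subst (λ z → hs [ z ]= a) (ℕP.+-comm 1 j) hs[j]=a

module Backward (P : Program) (E : Erasure) (safe : SafeErasure P E) (sig : ℕ → List Sort)
                (well-sorted : All (λ cl → All (λ A → map proj₁ (args A) ≡ sig (pred A)) (atomsOf cl)) P) where

  -- Well-sortedness ensures that the prescribed values of the erased
  -- positions have the sorts of the variables that receive them.
  sorts-of-eval : ∀ σ as → map proj₁ (evalArgs σ as) ≡ map proj₁ as
  sorts-of-eval σ [] = refl
  sorts-of-eval σ ((s , t) ∷ as) = cong (s ∷_) (sorts-of-eval σ as)

  -- Lift a derivation of p(ws) in P|E to any p(vs) whose kept arguments
  -- are ws: the last clause instance is extended by Extension, and the
  -- erased body atoms, unchanged by the extension, are lifted recursively.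
  mutual
    unerase-holds : ∀ {p ws} → Holds (eraseProg E P) p ws → ∀ vs →
                    Pointwise ValEq (dropG E p 1 vs) ws → map proj₁ vs ≡ sig p → Holds P p vs
    unerase-holds (derive cl'∈P' σ sat body-holds head≈) vs vs≈ws sorts with ∈-map⁻ (eraseClause E) cl'∈P'
    ... | cl , cl∈P , refl =
      derive cl∈P (assign ext) (satisfies ext)
        (unerase-body σ (assign ext) (body cl) (All.tail cl-sorts) body-unchanged body-holds)
        (matches ext)
      where
      cl-sorts : All (λ A → map proj₁ (args A) ≡ sig (pred A)) (atomsOf cl)
      cl-sorts = All.lookup well-sorted cl∈P
      cond : ∀ k → (pred (head cl) , k) ∈ E → CondAt E cl k
      cond k k∈E = safe k∈E cl∈P refl
      open Extension E cl cond σ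
      open Extended
      ext : Extended 1 (args (head cl)) vs σ
      ext = extend-head vs sat (Pointwise.transitive ValEq-trans vs≈ws (Pointwise.symmetric ValEq-sym head≈))
              (≡-trans sorts (sym (All.head cl-sorts)))
      body-unchanged : Agree σ (assign ext) (varsAtoms (map (eraseAtom E) (body cl)))
      body-unchanged Y Y∈G = sym (frame ext Y λ k _ k∈E → Erased.erased-body-unlinked k∈E Y Y∈G)

    unerase-body : ∀ σ σ' G → All (λ A → map proj₁ (args A) ≡ sig (pred A)) G →
                   Agree σ σ' (varsAtoms (map (eraseAtom E) G)) →
                   All (λ A → Holds (eraseProg E P) (pred A) (evalArgs σ (args A))) (map (eraseAtom E) G) →
                   All (λ A → Holds P (pred A) (evalArgs σ' (args A))) G
    unerase-body σ σ' [] _ _ [] = []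
    unerase-body σ σ' (A ∷ G) (A-sorts ∷ G-sorts) agree (h ∷ hs) =
      unerase-holds h (evalArgs σ' (args A))
        (subst (λ z → Pointwise ValEq z (evalArgs σ (dropArgs E (pred A) 1 (args A))))
               (eval-drop σ' E (pred A) (args A))
               (agree-args (dropArgs E (pred A) 1 (args A)) (λ Y Y∈A → sym (agree-++ˡ agree Y Y∈A))))
        (≡-trans (sorts-of-eval σ' (args A)) A-sorts)
      ∷ unerase-body σ σ' G G-sorts (agree-++ʳ (varsAtom (eraseAtom E A)) agree) hs

theorem2 : (P : Program) (u : ℕ) → WellFormed P u →
    Terminates P
    × ¬ ¬ (∃ λ E → Reachable P E × SafeErasure P E)
    × (∀ E → Reachable P E → SafeErasure P E →
         Holds P u [] ⇔ Holds (eraseProg E P) u [])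
theorem2 P u (sig , well-sorted , unsafe-nullary) =
  terminates ,
  reach-safe P (fullErasure P) terminates ε ,
  λ E _ safe → mk⇔ (Forward.erase-holds P E)
                   (λ h → Backward.unerase-holds P E safe sig well-sorted h [] [] (sym unsafe-nullary))
  where
  terminates : Terminates P
  terminates = cFAR-wellFounded P (fullErasure P)
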